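{- Let $m>1$ and $n\in\mathbb N_0$, and write $n=a_0+a_1m+\dots+a_sm^s$ with $1\le a_j\le m-1$ for $j=0,\dots,s$. Then $$\overline{b}_m(mn)\equiv\prod_{i=0}^{s}(2a_i+1)+2m\Bigg(\sum_{i=1}^{s}a_i^2\prod_{\substack{j=0\\ j\ne i,\,i-1}}^{s}(2a_j+1)\Bigg)\pmod{m^2}.$$
   Context: The sequence $(\overline{b}_m(n))_{n\in\mathbb N_0}$ is defined by $\overline{b}_m(0)=1$, $\overline{b}_m(mn)=\overline{b}_m(mn+1)=\dots=\overline{b}_m(mn+m-1)$ for $n\ge0$, and $\overline{b}_m(mn)-\overline{b}_m(mn-1)=\overline{b}_m(n)+\overline{b}_m(n-1)$ for $n\ge1$. Empty sums are $0$ and empty products are $1$. -}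

module Defs where

open import Data.Nat using (ℕ; zero; suc; _+_; _*_; _∸_; _<_)
open import Data.Nat.Properties using (_≟_)
open import Data.Bool using (if_then_else_; _∨_)
open import Data.Product using (_×_)
open import Data.Integer using (ℤ; +_; _-_)
open import Data.Integer.Divisibility using (_∣_)
open import Relation.Nullary using (does)
open import Relation.Binary.PropositionalEquality using (_≡_)

sumTo : ℕ → (ℕ → ℕ) → ℕ
sumTo zero    f = 0
sumTo (suc k) f = sumTo k f + f k

prodTo : ℕ → (ℕ → ℕ) → ℕ
prodTo zero    f = 1
prodTo (suc k) f = prodTo k f * f k

-- b is the sequence \overline{b}_m of the paper: it satisfies the defining
-- relations (which determine it uniquely for m > 1).
IsBbar : ℕ → (ℕ → ℕ) → Set
IsBbar m b =
  (b 0 ≡ 1) ×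
  ((∀ n r → r < m → b (m * n + r) ≡ b (m * n)) ×
   (∀ n → b (m * suc n) ≡ b (m * suc n ∸ 1) + b (suc n) + b n))

_≡_[mod_] : ℕ → ℕ → ℕ → Set
x ≡ y [mod q ] = (+ q) ∣ ((+ x) - (+ y))

-- Π_{j=0, j ≠ i, j ≠ i-1}^{k-1} f j   (for i ≥ 1)
prodExcept : ℕ → ℕ → (ℕ → ℕ) → ℕ
prodExcept k i f =
  prodTo k (λ j → if does (j ≟ i) ∨ does (j ≟ i ∸ 1) then 1 else f j)

{-# OPTIONS --safe #-}
module Submission where

-- Put c n = b̄(mn) and S n = Σ_{i<n} c i.  The recurrence telescopes to
-- c n = b̄ n + 2 Σ_{i<n} b̄ i, and as b̄ is constant on blocks of length m, a digit r < m gives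
--   c (mq + r) = (2r + 1) c q + 2m S q.
-- Summing this over a block, S (mq + r) ≡ r² c q (mod m).  Peeling off the lowest digit of
-- n = m n′ + a₀ and then of n′ = m n″ + a₁, the first identity multiplies the congruence for
-- c n′ by 2a₀ + 1, while 2m S n′ ≡ 2m a₁² c n″ (mod m²) only needs c n″ mod m, i.e. the
-- product over the remaining digits.

open import Defs
open import Data.Nat using (ℕ; zero; suc; _+_; _*_; _^_; _∸_; _≤_; _<_; s≤s; z≤n)
open import Data.Nat.Properties
  using (+-suc; *-suc; *-zeroʳ; *-identityˡ; *-identityʳ; *-assoc; *-comm; +-assoc; +-comm;
         +-identityʳ; *-distribˡ-+; *-commutativeSemigroup; n<1+n; <⇒≤; ≤-refl)
import Data.Nat.Divisibility as ℕ
open import Algebra.Properties.CommutativeSemigroup *-commutativeSemigroup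
  using () renaming (x∙yz≈y∙xz to x*[y*z]≡y*[x*z])
open import Data.Nat.Tactic.RingSolver using (solve-∀)
open import Data.Integer as ℤ using (ℤ)
import Data.Integer.Properties as ℤ
import Data.Integer.Divisibility.Signed as Signed
import Data.Integer.Tactic.RingSolver as ℤ-Solver
open import Data.Product using (_×_; proj₁; proj₂)
open import Function using (_∘_)
open import Relation.Binary.Bundles using (Setoid)
open import Relation.Binary.Structures using (IsEquivalence)
import Relation.Binary.Reasoning.Setoid as SetoidReasoning
open import Relation.Binary.PropositionalEquality
  using (_≡_; refl; sym; trans; cong; cong₂; subst; module ≡-Reasoning)

-- x ≡ y [mod q ] unfolds to an expression from which Agda cannot infer x and y; this
-- record variant keeps them as indices, and is converted back at the end.
infix 4 _≈_[mod_]
record _≈_[mod_] (x y q : ℕ) : Set where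
  constructor divides-difference
  field ∣-difference : ℤ.+ q Signed.∣ ℤ.+ x ℤ.- ℤ.+ y

module _ where
  open import Data.Integer using (+_; -_; _-_)

  ≈-mod⇒≡-mod : ∀ {x y q} → x ≈ y [mod q ] → x ≡ y [mod q ]
  ≈-mod⇒≡-mod (divides-difference q∣x-y) = Signed.∣⇒∣ᵤ q∣x-y

  ∣⇒≈-mod : ∀ {q x y} {d : ℤ} → + q Signed.∣ d → d ≡ + x - + y → x ≈ y [mod q ]
  ∣⇒≈-mod q∣d refl = divides-difference q∣d

  pos-*-distribˡ-minus : ∀ k x y → + k ℤ.* (+ x - + y) ≡ + (k * x) - + (k * y)
  pos-*-distribˡ-minus k x y =
    trans (distrib (+ k) (+ x) (+ y)) (sym (cong₂ _-_ (ℤ.pos-* k x) (ℤ.pos-* k y)))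
    where
    distrib : ∀ u v w → u ℤ.* (v - w) ≡ u ℤ.* v - u ℤ.* w
    distrib = ℤ-Solver.solve-∀

  module _ {q : ℕ} where

    ≈-mod-reflexive : ∀ {x y} → x ≡ y → x ≈ y [mod q ]
    ≈-mod-reflexive {x} refl =
      ∣⇒≈-mod (Signed.divides (+ 0) (sym (ℤ.*-zeroˡ (+ q)))) (sym (ℤ.+-inverseʳ (+ x)))

    ≈-mod-sym : ∀ {x y} → x ≈ y [mod q ] → y ≈ x [mod q ]
    ≈-mod-sym {x} {y} (divides-difference q∣x-y) =
      ∣⇒≈-mod (Signed.∣m⇒∣-m q∣x-y) (neg-minus (+ x) (+ y))
      where
      neg-minus : ∀ u v → - (u - v) ≡ v - u
      neg-minus = ℤ-Solver.solve-∀

    ≈-mod-trans : ∀ {x y z} → x ≈ y [mod q ] → y ≈ z [mod q ] → x ≈ z [mod q ]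
    ≈-mod-trans {x} {y} {z} (divides-difference q∣x-y) (divides-difference q∣y-z) =
      ∣⇒≈-mod (Signed.∣m∣n⇒∣m+n q∣x-y q∣y-z) (telescope (+ x) (+ y) (+ z))
      where
      telescope : ∀ u v w → (u - v) ℤ.+ (v - w) ≡ u - w
      telescope = ℤ-Solver.solve-∀

    ≈-mod-isEquivalence : IsEquivalence (λ x y → x ≈ y [mod q ])
    ≈-mod-isEquivalence = record
      { refl = ≈-mod-reflexive refl ; sym = ≈-mod-sym ; trans = ≈-mod-trans }

    ≈-mod-+ : ∀ {x x′ y y′} →
              x ≈ x′ [mod q ] → y ≈ y′ [mod q ] → x + y ≈ x′ + y′ [mod q ]
    ≈-mod-+ {x} {x′} {y} {y′} (divides-difference q∣x-x′) (divides-difference q∣y-y′) =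
      ∣⇒≈-mod (Signed.∣m∣n⇒∣m+n q∣x-x′ q∣y-y′) (begin
        (+ x - + x′) ℤ.+ (+ y - + y′)    ≡⟨ regroup (+ x) (+ x′) (+ y) (+ y′) ⟩
        (+ x ℤ.+ + y) - (+ x′ ℤ.+ + y′)  ≡⟨ cong₂ _-_ (ℤ.pos-+ x y) (ℤ.pos-+ x′ y′) ⟨
        + (x + y) - + (x′ + y′)          ∎)
      where
      open ≡-Reasoning
      regroup : ∀ u u′ v v′ → (u - u′) ℤ.+ (v - v′) ≡ (u ℤ.+ v) - (u′ ℤ.+ v′)
      regroup = ℤ-Solver.solve-∀

    ≈-mod-*ˡ : ∀ k {x y} → x ≈ y [mod q ] → k * x ≈ k * y [mod q ]
    ≈-mod-*ˡ k {x} {y} (divides-difference q∣x-y) =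
      ∣⇒≈-mod (Signed.∣n⇒∣m*n (+ k) q∣x-y) (pos-*-distribˡ-minus k x y)

    ≈-mod-scale : ∀ k {x y} → x ≈ y [mod q ] → k * x ≈ k * y [mod k * q ]
    ≈-mod-scale k {x} {y} (divides-difference q∣x-y) = ∣⇒≈-mod
      (subst (Signed._∣ (+ k ℤ.* (+ x - + y))) (sym (ℤ.pos-* k q)) (Signed.*-monoʳ-∣ (+ k) q∣x-y))
      (pos-*-distribˡ-minus k x y)

    ≈-mod-+-multiple : ∀ x {d} → q ℕ.∣ d → x + d ≈ x [mod q ]
    ≈-mod-+-multiple x {d} q∣d = ∣⇒≈-mod (Signed.∣ᵤ⇒∣ q∣d) (sym (begin
      + (x + d) - + x      ≡⟨ cong (_- + x) (ℤ.pos-+ x d) ⟩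
      (+ x ℤ.+ + d) - + x  ≡⟨ cancel (+ x) (+ d) ⟩
      + d                  ∎))
      where
      open ≡-Reasoning
      cancel : ∀ u v → (u ℤ.+ v) - u ≡ v
      cancel = ℤ-Solver.solve-∀

  ≈-mod-∣ : ∀ {d q x y} → d ℕ.∣ q → x ≈ y [mod q ] → x ≈ y [mod d ]
  ≈-mod-∣ d∣q (divides-difference q∣x-y) =
    divides-difference (Signed.∣-trans (Signed.∣ᵤ⇒∣ d∣q) q∣x-y)

≈-mod-setoid : ℕ → Setoid _ _
≈-mod-setoid q = record { isEquivalence = ≈-mod-isEquivalence {q} }

module ≈-mod-Reasoning (q : ℕ) = SetoidReasoning (≈-mod-setoid q)

sumTo-cong : ∀ k {f g : ℕ → ℕ} → (∀ i → f i ≡ g i) → sumTo k f ≡ sumTo k g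
sumTo-cong zero    f≗g = refl
sumTo-cong (suc k) f≗g = cong₂ _+_ (sumTo-cong k f≗g) (f≗g k)

sumTo-shift : ∀ k (f : ℕ → ℕ) → sumTo (suc k) f ≡ f 0 + sumTo k (f ∘ suc)
sumTo-shift zero    f = +-comm 0 (f 0)
sumTo-shift (suc k) f = trans (cong (_+ f (suc k)) (sumTo-shift k f)) (+-assoc (f 0) _ _)

prodTo-shift : ∀ k (f : ℕ → ℕ) → prodTo (suc k) f ≡ f 0 * prodTo k (f ∘ suc)
prodTo-shift zero    f = *-comm 1 (f 0)
prodTo-shift (suc k) f = trans (cong (_* f (suc k)) (prodTo-shift k f)) (*-assoc (f 0) _ _)

sumTo-*-distribˡ : ∀ k c (f : ℕ → ℕ) → sumTo k (λ i → c * f i) ≡ c * sumTo k f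
sumTo-*-distribˡ zero    c f = sym (*-zeroʳ c)
sumTo-*-distribˡ (suc k) c f =
  trans (cong (_+ c * f k) (sumTo-*-distribˡ k c f)) (sym (*-distribˡ-+ c _ _))

sumTo-digits : ∀ m k (a : ℕ → ℕ) →
               sumTo (suc k) (λ j → a j * m ^ j) ≡ m * sumTo k (λ j → a (suc j) * m ^ j) + a 0
sumTo-digits m k a = begin
  sumTo (suc k) (λ j → a j * m ^ j)
    ≡⟨ sumTo-shift k _ ⟩
  a 0 * 1 + sumTo k (λ j → a (suc j) * (m * m ^ j))
    ≡⟨ cong₂ _+_ (*-identityʳ (a 0)) (sumTo-cong k λ j → x*[y*z]≡y*[x*z] (a (suc j)) m (m ^ j)) ⟩
  a 0 + sumTo k (λ j → m * (a (suc j) * m ^ j))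
    ≡⟨ cong (a 0 +_) (sumTo-*-distribˡ k m _) ⟩
  a 0 + m * sumTo k (λ j → a (suc j) * m ^ j)
    ≡⟨ +-comm (a 0) _ ⟩
  m * sumTo k (λ j → a (suc j) * m ^ j) + a 0
    ∎
  where open ≡-Reasoning

pairSum : (w f : ℕ → ℕ) → ℕ → ℕ
pairSum w f k = sumTo (k ∸ 1) (λ i → w (suc i) * prodExcept k (suc i) f)

pairSum-shift : ∀ k (w f : ℕ → ℕ) →
                pairSum w f (suc (suc k))
                ≡ w 1 * prodTo k (f ∘ suc ∘ suc) + f 0 * pairSum (w ∘ suc) (f ∘ suc) (suc k)
pairSum-shift k w f = begin
  pairSum w f (suc (suc k))
    ≡⟨ sumTo-shift k _ ⟩
  w 1 * prodExcept (suc (suc k)) 1 f + sumTo k (λ i → term (suc i))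
    ≡⟨ cong₂ _+_ (cong (w 1 *_) first-term) (sumTo-cong k later-term) ⟩
  w 1 * prodTo k (f ∘ suc ∘ suc) + sumTo k (λ i → f 0 * term′ i)
    ≡⟨ cong (w 1 * prodTo k (f ∘ suc ∘ suc) +_) (sumTo-*-distribˡ k (f 0) term′) ⟩
  w 1 * prodTo k (f ∘ suc ∘ suc) + f 0 * pairSum (w ∘ suc) (f ∘ suc) (suc k)
    ∎
  where
  open ≡-Reasoning
  term term′ : ℕ → ℕ
  term i = w (suc i) * prodExcept (suc (suc k)) (suc i) f
  term′ i = w (suc (suc i)) * prodExcept (suc k) (suc i) (f ∘ suc)
  first-term : prodExcept (suc (suc k)) 1 f ≡ prodTo k (f ∘ suc ∘ suc)
  first-term = begin
    prodExcept (suc (suc k)) 1 f   ≡⟨ prodTo-shift (suc k) _ ⟩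
    1 * prodTo (suc k) _           ≡⟨ *-identityˡ _ ⟩
    prodTo (suc k) _               ≡⟨ prodTo-shift k _ ⟩
    1 * prodTo k (f ∘ suc ∘ suc)   ≡⟨ *-identityˡ _ ⟩
    prodTo k (f ∘ suc ∘ suc)       ∎
  later-term : ∀ i → term (suc i) ≡ f 0 * term′ i
  later-term i = trans (cong (w (suc (suc i)) *_) (prodTo-shift (suc k) _))
                       (x*[y*z]≡y*[x*z] (w (suc (suc i))) (f 0) _)

module Bbar (m-1 : ℕ) (b : ℕ → ℕ) (bbar : IsBbar (suc m-1) b) where

  m : ℕ
  m = suc m-1

  c : ℕ → ℕ
  c n = b (m * n)

  S : ℕ → ℕ
  S n = sumTo n c

  c0≡1 : c 0 ≡ 1
  c0≡1 = trans (cong b (*-zeroʳ m)) (proj₁ bbar)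

  b-block : ∀ q r → r < m → b (m * q + r) ≡ c q
  b-block = proj₁ (proj₂ bbar)

  c≡b+2Σb : ∀ n → c n ≡ b n + 2 * sumTo n b
  c≡b+2Σb zero    = trans (cong b (*-zeroʳ m)) (sym (+-identityʳ (b 0)))
  c≡b+2Σb (suc n) = begin
    c (suc n)                               ≡⟨ proj₂ (proj₂ bbar) n ⟩
    b (m * suc n ∸ 1) + b (suc n) + b n     ≡⟨ cong (λ x → x + b (suc n) + b n) previous ⟩
    b n + 2 * sumTo n b + b (suc n) + b n   ≡⟨ regroup (b n) (sumTo n b) (b (suc n)) ⟩
    b (suc n) + 2 * sumTo (suc n) b         ∎
    where
    open ≡-Reasoning
    last-of-block : ∀ n k → n + k * (1 + n) ≡ n + k * n + k
    last-of-block = solve-∀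
    previous : b (m * suc n ∸ 1) ≡ b n + 2 * sumTo n b
    previous = trans (cong b (last-of-block n m-1))
                     (trans (b-block n m-1 (n<1+n m-1)) (c≡b+2Σb n))
    regroup : ∀ x s y → x + 2 * s + y + x ≡ y + 2 * (s + x)
    regroup = solve-∀

  sumTo-b-in-block : ∀ q r → r ≤ m → sumTo (m * q + r) b ≡ sumTo (m * q) b + r * c q
  sumTo-b-in-block q zero    _   =
    trans (cong (λ n → sumTo n b) (+-identityʳ (m * q))) (sym (+-identityʳ _))
  sumTo-b-in-block q (suc r) r<m = begin
    sumTo (m * q + suc r) b
      ≡⟨ cong (λ n → sumTo n b) (+-suc (m * q) r) ⟩
    sumTo (m * q + r) b + b (m * q + r)
      ≡⟨ cong₂ _+_ (sumTo-b-in-block q r (<⇒≤ r<m)) (b-block q r r<m) ⟩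
    sumTo (m * q) b + r * c q + c q
      ≡⟨ +-assoc (sumTo (m * q) b) (r * c q) (c q) ⟩
    sumTo (m * q) b + (r * c q + c q)
      ≡⟨ cong (sumTo (m * q) b +_) (+-comm (r * c q) (c q)) ⟩
    sumTo (m * q) b + suc r * c q
      ∎
    where open ≡-Reasoning

  m*[1+q]≡m*q+m : ∀ q → m * suc q ≡ m * q + m
  m*[1+q]≡m*q+m q = trans (*-suc m q) (+-comm m (m * q))

  sumTo-b-block-start : ∀ q → sumTo (m * q) b ≡ m * S q
  sumTo-b-block-start zero    = trans (cong (λ n → sumTo n b) (*-zeroʳ m)) (sym (*-zeroʳ m))
  sumTo-b-block-start (suc q) = begin
    sumTo (m * suc q) b         ≡⟨ cong (λ n → sumTo n b) (m*[1+q]≡m*q+m q) ⟩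
    sumTo (m * q + m) b         ≡⟨ sumTo-b-in-block q m ≤-refl ⟩
    sumTo (m * q) b + m * c q   ≡⟨ cong (_+ m * c q) (sumTo-b-block-start q) ⟩
    m * S q + m * c q           ≡⟨ sym (*-distribˡ-+ m (S q) (c q)) ⟩
    m * S (suc q)               ∎
    where open ≡-Reasoning

  c-digit : ∀ q r → r < m → c (m * q + r) ≡ (2 * r + 1) * c q + 2 * m * S q
  c-digit q r r<m = begin
    c (m * q + r)                             ≡⟨ c≡b+2Σb (m * q + r) ⟩
    b (m * q + r) + 2 * sumTo (m * q + r) b   ≡⟨ cong₂ (λ x s → x + 2 * s) (b-block q r r<m) prefix ⟩
    c q + 2 * (m * S q + r * c q)             ≡⟨ regroup (c q) m (S q) r ⟩
    (2 * r + 1) * c q + 2 * m * S q           ∎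
    where
    open ≡-Reasoning
    prefix : sumTo (m * q + r) b ≡ m * S q + r * c q
    prefix = trans (sumTo-b-in-block q r (<⇒≤ r<m)) (cong (_+ r * c q) (sumTo-b-block-start q))
    regroup : ∀ x m s r → x + 2 * (m * s + r * x) ≡ (2 * r + 1) * x + 2 * m * s
    regroup = solve-∀

  S-in-block : ∀ q r → r ≤ m → S (m * q + r) ≡ r * r * c q + (S (m * q) + m * (2 * r * S q))
  S-in-block q zero    _   = trans (cong S (+-identityʳ (m * q))) (pad (S (m * q)) m)
    where
    pad : ∀ s m → s ≡ s + m * 0
    pad = solve-∀
  S-in-block q (suc r) r<m = begin
    S (m * q + suc r)
      ≡⟨ cong S (+-suc (m * q) r) ⟩
    S (m * q + r) + c (m * q + r)
      ≡⟨ cong₂ _+_ (S-in-block q r (<⇒≤ r<m)) (c-digit q r r<m) ⟩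
    r * r * c q + (S (m * q) + m * (2 * r * S q)) + ((2 * r + 1) * c q + 2 * m * S q)
      ≡⟨ regroup r (c q) (S (m * q)) m (S q) ⟩
    suc r * suc r * c q + (S (m * q) + m * (2 * suc r * S q))
      ∎
    where
    open ≡-Reasoning
    regroup : ∀ r x s₀ m s →
              r * r * x + (s₀ + m * (2 * r * s)) + ((2 * r + 1) * x + 2 * m * s)
              ≡ (1 + r) * (1 + r) * x + (s₀ + m * (2 * (1 + r) * s))
    regroup = solve-∀

  m∣S-block-start : ∀ q → m ℕ.∣ S (m * q)
  m∣S-block-start zero    = subst (λ n → m ℕ.∣ S n) (sym (*-zeroʳ m)) (m ℕ.∣0)
  m∣S-block-start (suc q) = subst (m ℕ.∣_) (sym S-next-block-start) divisible
    where
    S-next-block-start : S (m * suc q) ≡ m * m * c q + (S (m * q) + m * (2 * m * S q))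
    S-next-block-start = trans (cong S (m*[1+q]≡m*q+m q)) (S-in-block q m ≤-refl)
    divisible : m ℕ.∣ m * m * c q + (S (m * q) + m * (2 * m * S q))
    divisible = ℕ.∣m∣n⇒∣m+n (ℕ.∣m⇒∣m*n (c q) (ℕ.m∣m*n m))
                            (ℕ.∣m∣n⇒∣m+n (m∣S-block-start q) (ℕ.m∣m*n _))

  S-digit : ∀ q r → r ≤ m → S (m * q + r) ≈ r * r * c q [mod m ]
  S-digit q r r≤m = ≈-mod-trans (≈-mod-reflexive (S-in-block q r r≤m))
    (≈-mod-+-multiple (r * r * c q) (ℕ.∣m∣n⇒∣m+n (m∣S-block-start q) (ℕ.m∣m*n _)))

  2m*S-digit : ∀ q r {p} → r ≤ m → c q ≈ p [mod m ] →
               2 * m * S (m * q + r) ≈ 2 * m * (r * r * p) [mod m * m ]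
  2m*S-digit q r {p} r≤m cq≈p = ≈-mod-∣ (ℕ.divides 2 (*-assoc 2 m m)) (≈-mod-scale (2 * m) S≈r²p)
    where
    S≈r²p : S (m * q + r) ≈ r * r * p [mod m ]
    S≈r²p = ≈-mod-trans (S-digit q r r≤m) (≈-mod-*ˡ (r * r) cq≈p)

  c-digits : ∀ k (a : ℕ → ℕ) → (∀ j → j < k → a j < m) →
             c (sumTo k (λ j → a j * m ^ j))
             ≈ prodTo k (λ j → 2 * a j + 1) + 2 * m * pairSum (λ i → a i * a i) (λ j → 2 * a j + 1) k
             [mod m * m ]
  c-digits zero          a _   = ≈-mod-reflexive (trans c0≡1 (cong (1 +_) (sym (*-zeroʳ (2 * m)))))
  c-digits (suc zero)    a a<m = ≈-mod-reflexive (begin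
    c (sumTo 1 (λ j → a j * m ^ j))   ≡⟨ cong c (sumTo-digits m 0 a) ⟩
    c (m * 0 + a 0)                   ≡⟨ c-digit 0 (a 0) (a<m 0 (s≤s z≤n)) ⟩
    (2 * a 0 + 1) * c 0 + 2 * m * 0   ≡⟨ cong (λ x → (2 * a 0 + 1) * x + 2 * m * 0) c0≡1 ⟩
    (2 * a 0 + 1) * 1 + 2 * m * 0     ≡⟨ cong (_+ 2 * m * 0) (*-comm (2 * a 0 + 1) 1) ⟩
    1 * (2 * a 0 + 1) + 2 * m * 0     ∎)
    where open ≡-Reasoning
  c-digits (suc (suc k)) a a<m = let open ≈-mod-Reasoning (m * m) in begin
    c (sumTo (suc (suc k)) (λ j → a j * m ^ j))
      ≡⟨ cong c (sumTo-digits m (suc k) a) ⟩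
    c (m * n′ + a 0)
      ≡⟨ c-digit n′ (a 0) (a<m 0 (s≤s z≤n)) ⟩
    f 0 * c n′ + 2 * m * S n′
      ≈⟨ ≈-mod-+ (≈-mod-*ˡ (f 0) (c-digits (suc k) a′ a′<m)) S-term ⟩
    f 0 * (P′ + 2 * m * Q′) + 2 * m * (w 1 * P″)
      ≡⟨ regroup (f 0) P′ m Q′ (w 1 * P″) ⟩
    f 0 * P′ + 2 * m * (w 1 * P″ + f 0 * Q′)
      ≡⟨ sym (cong₂ (λ p s → p + 2 * m * s) (prodTo-shift (suc k) f) (pairSum-shift k w f)) ⟩
    prodTo (suc (suc k)) f + 2 * m * pairSum w f (suc (suc k))
      ∎
    where
    w f : ℕ → ℕ
    w i = a i * a i
    f j = 2 * a j + 1
    a′ a″ : ℕ → ℕ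
    a′ = a ∘ suc
    a″ = a ∘ suc ∘ suc
    a′<m : ∀ j → j < suc k → a′ j < m
    a′<m j j<1+k = a<m (suc j) (s≤s j<1+k)
    a″<m : ∀ j → j < k → a″ j < m
    a″<m j j<k = a<m (suc (suc j)) (s≤s (s≤s j<k))
    n′ n″ P′ Q′ P″ Q″ : ℕ
    n′ = sumTo (suc k) (λ j → a′ j * m ^ j)
    n″ = sumTo k (λ j → a″ j * m ^ j)
    P′ = prodTo (suc k) (f ∘ suc)
    Q′ = pairSum (w ∘ suc) (f ∘ suc) (suc k)
    P″ = prodTo k (f ∘ suc ∘ suc)
    Q″ = pairSum (w ∘ suc ∘ suc) (f ∘ suc ∘ suc) k
    c-n″ : c n″ ≈ P″ [mod m ]
    c-n″ = ≈-mod-trans (≈-mod-∣ (ℕ.m∣m*n m) (c-digits k a″ a″<m))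
                       (≈-mod-+-multiple P″ (ℕ.∣m⇒∣m*n Q″ (ℕ.n∣m*n 2)))
    S-term : 2 * m * S n′ ≈ 2 * m * (w 1 * P″) [mod m * m ]
    S-term = ≈-mod-trans (≈-mod-reflexive (cong (λ n → 2 * m * S n) (sumTo-digits m k a′)))
                         (2m*S-digit n″ (a 1) (<⇒≤ (a<m 1 (s≤s (s≤s z≤n)))) c-n″)
    regroup : ∀ x p m q t → x * (p + 2 * m * q) + 2 * m * t ≡ x * p + 2 * m * (t + x * q)
    regroup = solve-∀

theorem13 : (m : ℕ) → 1 < m → (b : ℕ → ℕ) → IsBbar m b →
            (n k : ℕ) (a : ℕ → ℕ) →
            (∀ j → j < k → (1 ≤ a j) × (a j < m)) →
            n ≡ sumTo k (λ j → a j * m ^ j) →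
            b (m * n) ≡ prodTo k (λ j → 2 * a j + 1)
                        + 2 * m * sumTo (k ∸ 1) (λ i → a (suc i) * a (suc i) * prodExcept k (suc i) (λ j → 2 * a j + 1))
                        [mod m * m ]
theorem13 (suc m-1) _ b bbar n k a digits refl =
  ≈-mod⇒≡-mod (Bbar.c-digits m-1 b bbar k a (λ j j<k → proj₂ (digits j j<k)))
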